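{- For every non-negative integer $n$ and every integer $s$, \[ \sum_{k = 0}^{\lfloor n/2 \rfloor } \binom {n}{2k} F_{6k + s}= 2^{n-1} \big(F_{2n+s} + (-1)^n F_{n+s}\big),\qquad \sum_{k = 0}^{\lfloor n/2 \rfloor } \binom {n}{2k} L_{6k + s}= 2^{n-1} \big(L_{2n+s} + (-1)^n L_{n+s}\big). \]
   Context: The Fibonacci numbers $F_j$ and Lucas numbers $L_j$ are defined for all integers $j$ by $F_0=0$, $F_1=1$, $L_0=2$, $L_1=1$, $F_j=F_{j-1}+F_{j-2}$, $L_j=L_{j-1}+L_{j-2}$, with $F_{ -j}=(-1)^{j-1}F_j$ and $L_{ -j}=(-1)^jL_j$. -}

module Defs where

open import Data.Nat as ℕ using (ℕ; zero; suc)
open import Data.Integer as ℤ using (ℤ; +_; -[1+_]; _+_; _*_; -_)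
open import Data.Nat.Combinatorics using (_C_)
open import Data.Nat.Base using (⌊_/2⌋)

fibℕ : ℕ → ℤ
fibℕ zero = + 0
fibℕ (suc zero) = + 1
fibℕ (suc (suc n)) = fibℕ (suc n) + fibℕ n

lucℕ : ℕ → ℤ
lucℕ zero = + 2
lucℕ (suc zero) = + 1
lucℕ (suc (suc n)) = lucℕ (suc n) + lucℕ n

sign : ℕ → ℤ
sign zero = + 1
sign (suc n) = - sign n

-- Extension to all integers: F_{-j} = (-1)^(j-1) F_j, L_{-j} = (-1)^j L_j
F : ℤ → ℤ
F (+ n) = fibℕ n
F -[1+ m ] = sign m * fibℕ (suc m)          -- j = m+1, (-1)^(j-1) = (-1)^m

L : ℤ → ℤ
L (+ n) = lucℕ n
L -[1+ m ] = sign (suc m) * lucℕ (suc m)    -- (-1)^j with j = m+1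

sumTo : ℕ → (ℕ → ℤ) → ℤ
sumTo zero f = f zero
sumTo (suc m) f = sumTo m f + f (suc m)

-- Both identities hold for every integer-indexed sequence G with G(z+2) = G(z+1) + G(z).
-- For such G one has G(a) + G(a+3) = 2 G(a+2) and G(a) − G(a+3) = −2 G(a+1); feeding these
-- shift relations into Pascal's rule gives, by induction on n,
--   Σ_j C(n,j) G(3j+s) = 2^n G(2n+s)   and   Σ_j C(n,j) (−1)^j G(3j+s) = (−2)^n G(n+s).
-- Adding the two kills the odd-j terms and doubles the even ones.
module Submission where

open import Defs
open import Data.Nat as ℕ using (ℕ; zero; suc; ⌊_/2⌋; _≤′_; ≤′-refl; ≤′-step)
import Data.Nat.Properties as ℕ
open import Data.Nat.Combinatorics using (_C_; nCk+nC[k+1]≡[n+1]C[k+1]; k>n⇒nCk≡0)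
open import Data.Integer using (ℤ; +_; -[1+_]; 1ℤ; _+_; _*_; -_; _-_; _^_)
open import Data.Integer.Properties
  using (+-assoc; *-assoc; +-identityʳ; *-identityˡ; *-distribʳ-+; *-distribˡ-+; pos-+; ^-zeroˡ; ^-*-assoc)
open import Data.Integer.Tactic.RingSolver using (solve-∀)
open import Data.Product using (_×_; _,_)
open import Relation.Binary.PropositionalEquality using (_≡_; refl; sym; trans; cong; cong₂)
open import Relation.Binary.PropositionalEquality.Properties using (module ≡-Reasoning)
open ≡-Reasoning

F-recurrence : ∀ z → F (z + + 2) ≡ F (z + + 1) + F z
F-recurrence (+ n) rewrite ℕ.+-comm n 2 | ℕ.+-comm n 1 = refl
F-recurrence -[1+ 0 ] = refl
F-recurrence -[1+ 1 ] = refl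
F-recurrence -[1+ suc (suc m) ] = identity (sign m) (fibℕ (suc m)) (fibℕ m)
  where
  identity : ∀ σ x y → σ * x ≡ (- σ) * (x + y) + (- (- σ)) * ((x + y) + x)
  identity = solve-∀

L-recurrence : ∀ z → L (z + + 2) ≡ L (z + + 1) + L z
L-recurrence (+ n) rewrite ℕ.+-comm n 2 | ℕ.+-comm n 1 = refl
L-recurrence -[1+ 0 ] = refl
L-recurrence -[1+ 1 ] = refl
L-recurrence -[1+ suc (suc m) ] = identity (sign m) (lucℕ (suc m)) (lucℕ m)
  where
  identity : ∀ σ x y → (- σ) * x ≡ (- (- σ)) * (x + y) + (- (- (- σ))) * ((x + y) + x)
  identity = solve-∀

neg-^ : ∀ i n → (- i) ^ n ≡ sign n * i ^ n
neg-^ i zero = refl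
neg-^ i (suc n) = begin
  - i * (- i) ^ n        ≡⟨ cong (- i *_) (neg-^ i n) ⟩
  - i * (sign n * i ^ n) ≡⟨ identity i (sign n) (i ^ n) ⟩
  - sign n * (i * i ^ n) ∎
  where
  identity : ∀ i σ x → - i * (σ * x) ≡ - σ * (i * x)
  identity = solve-∀

-1^-even : ∀ k → (- 1ℤ) ^ (2 ℕ.* k) ≡ 1ℤ
-1^-even k = trans (sym (^-*-assoc (- 1ℤ) 2 k)) (^-zeroˡ k)

shift-index : ∀ d j s → + (d ℕ.* suc j) + s ≡ (+ (d ℕ.* j) + s) + + d
shift-index d j s = begin
  + (d ℕ.* suc j) + s     ≡⟨ cong (λ t → + t + s) (ℕ.*-suc d j) ⟩
  + (d ℕ.+ d ℕ.* j) + s   ≡⟨ cong (_+ s) (pos-+ d (d ℕ.* j)) ⟩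
  + d + + (d ℕ.* j) + s   ≡⟨ identity (+ d) (+ (d ℕ.* j)) s ⟩
  (+ (d ℕ.* j) + s) + + d ∎
  where
  identity : ∀ x y s → x + y + s ≡ (y + s) + x
  identity = solve-∀

n≤1+2⌊n/2⌋ : ∀ n → n ≤′ suc (2 ℕ.* ⌊ n /2⌋)
n≤1+2⌊n/2⌋ n = ℕ.≤⇒≤′ (bound n)
  where
  bound : ∀ n → n ℕ.≤ suc (2 ℕ.* ⌊ n /2⌋)
  bound zero = ℕ.z≤n
  bound (suc zero) = ℕ.≤-refl
  bound (suc (suc n)) rewrite ℕ.*-suc 2 ⌊ n /2⌋ = ℕ.s≤s (ℕ.s≤s (bound n))

sumTo-cong : ∀ m {f g : ℕ → ℤ} → (∀ j → f j ≡ g j) → sumTo m f ≡ sumTo m g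
sumTo-cong zero f≡g = f≡g zero
sumTo-cong (suc m) f≡g = cong₂ _+_ (sumTo-cong m f≡g) (f≡g (suc m))

sumTo-suc : ∀ m (f : ℕ → ℤ) → sumTo (suc m) f ≡ f 0 + sumTo m (λ j → f (suc j))
sumTo-suc zero f = refl
sumTo-suc (suc m) f =
  trans (cong (_+ f (suc (suc m))) (sumTo-suc m f)) (+-assoc (f 0) _ _)

sumTo-+ : ∀ m (f g : ℕ → ℤ) → sumTo m (λ j → f j + g j) ≡ sumTo m f + sumTo m g
sumTo-+ zero f g = refl
sumTo-+ (suc m) f g =
  trans (cong (_+ (f (suc m) + g (suc m))) (sumTo-+ m f g))
        (interchange (sumTo m f) (sumTo m g) (f (suc m)) (g (suc m)))
  where
  interchange : ∀ a b c d → (a + b) + (c + d) ≡ (a + c) + (b + d)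
  interchange = solve-∀

sumTo-*ˡ : ∀ m c (f : ℕ → ℤ) → sumTo m (λ j → c * f j) ≡ c * sumTo m f
sumTo-*ˡ zero c f = refl
sumTo-*ˡ (suc m) c f =
  trans (cong (_+ (c * f (suc m))) (sumTo-*ˡ m c f)) (sym (*-distribˡ-+ c (sumTo m f) (f (suc m))))

sumTo-pairs : ∀ m (f : ℕ → ℤ) →
              sumTo (suc (2 ℕ.* m)) f ≡ sumTo m (λ k → f (2 ℕ.* k) + f (suc (2 ℕ.* k)))
sumTo-pairs zero f = refl
sumTo-pairs (suc m) f = begin
  sumTo (suc (2 ℕ.* suc m)) f
    ≡⟨ cong (λ t → sumTo (suc t) f) (ℕ.*-suc 2 m) ⟩
  (sumTo (suc (2 ℕ.* m)) f + f (2 ℕ.+ 2 ℕ.* m)) + f (3 ℕ.+ 2 ℕ.* m)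
    ≡⟨ cong (λ t → (t + f (2 ℕ.+ 2 ℕ.* m)) + f (3 ℕ.+ 2 ℕ.* m)) (sumTo-pairs m f) ⟩
  (P + f (2 ℕ.+ 2 ℕ.* m)) + f (3 ℕ.+ 2 ℕ.* m)
    ≡⟨ +-assoc P _ _ ⟩
  P + (f (2 ℕ.+ 2 ℕ.* m) + f (3 ℕ.+ 2 ℕ.* m))
    ≡⟨ cong (λ t → P + (f t + f (suc t))) (sym (ℕ.*-suc 2 m)) ⟩
  P + (f (2 ℕ.* suc m) + f (suc (2 ℕ.* suc m))) ∎
  where P = sumTo m (λ k → f (2 ℕ.* k) + f (suc (2 ℕ.* k)))

binomialSum : ℕ → (ℕ → ℤ) → ℤ
binomialSum n h = sumTo n (λ j → + (n C j) * h j)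

binomialSum-cong : ∀ n {g h : ℕ → ℤ} → (∀ j → g j ≡ h j) → binomialSum n g ≡ binomialSum n h
binomialSum-cong n g≡h = sumTo-cong n (λ j → cong (+ (n C j) *_) (g≡h j))

binomialSum-*ˡ : ∀ n c (h : ℕ → ℤ) → binomialSum n (λ j → c * h j) ≡ c * binomialSum n h
binomialSum-*ˡ n c h =
  trans (sumTo-cong n (λ j → swap (+ (n C j)) c (h j))) (sumTo-*ˡ n c (λ j → + (n C j) * h j))
  where
  swap : ∀ a c x → a * (c * x) ≡ c * (a * x)
  swap = solve-∀

binomialSum-extend : ∀ {n m} (h : ℕ → ℤ) → n ≤′ m →
                     sumTo m (λ j → + (n C j) * h j) ≡ binomialSum n h
binomialSum-extend h ≤′-refl = refl
binomialSum-extend {n} {suc m} h (≤′-step n≤m) = begin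
  sumTo m T + + (n C suc m) * h (suc m)
    ≡⟨ cong (λ t → sumTo m T + + t * h (suc m)) (k>n⇒nCk≡0 (ℕ.s≤s (ℕ.≤′⇒≤ n≤m))) ⟩
  sumTo m T + + 0   ≡⟨ +-identityʳ _ ⟩
  sumTo m T         ≡⟨ binomialSum-extend h n≤m ⟩
  binomialSum n h   ∎
  where T = λ j → + (n C j) * h j

binomialSum-suc : ∀ n (h : ℕ → ℤ) →
                  binomialSum (suc n) h ≡ binomialSum n h + binomialSum n (λ j → h (suc j))
binomialSum-suc n h = begin
  binomialSum (suc n) h
    ≡⟨ sumTo-suc n _ ⟩
  + 1 * h 0 + sumTo n (λ j → + (suc n C suc j) * h (suc j))
    ≡⟨ cong (λ t → + 1 * h 0 + t) (sumTo-cong n pascal) ⟩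
  + 1 * h 0 + sumTo n (λ j → + (n C j) * h (suc j) + + (n C suc j) * h (suc j))
    ≡⟨ cong (λ t → + 1 * h 0 + t) (sumTo-+ n _ _) ⟩
  + 1 * h 0 + (binomialSum n (λ j → h (suc j)) + R)
    ≡⟨ rotate (+ 1 * h 0) _ R ⟩
  (+ 1 * h 0 + R) + binomialSum n (λ j → h (suc j))
    ≡⟨ cong (_+ binomialSum n (λ j → h (suc j))) (sym (sumTo-suc n (λ j → + (n C j) * h j))) ⟩
  sumTo (suc n) (λ j → + (n C j) * h j) + binomialSum n (λ j → h (suc j))
    ≡⟨ cong (_+ binomialSum n (λ j → h (suc j))) (binomialSum-extend {n} h (≤′-step ≤′-refl)) ⟩
  binomialSum n h + binomialSum n (λ j → h (suc j)) ∎
  where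
  R = sumTo n (λ j → + (n C suc j) * h (suc j))
  rotate : ∀ a b c → a + (b + c) ≡ (a + c) + b
  rotate = solve-∀
  pascal : ∀ j → + (suc n C suc j) * h (suc j) ≡ + (n C j) * h (suc j) + + (n C suc j) * h (suc j)
  pascal j = begin
    + (suc n C suc j) * h (suc j)
      ≡⟨ cong (λ t → + t * h (suc j)) (sym (nCk+nC[k+1]≡[n+1]C[k+1] n j)) ⟩
    + (n C j ℕ.+ n C suc j) * h (suc j)
      ≡⟨ cong (_* h (suc j)) (pos-+ (n C j) (n C suc j)) ⟩
    (+ (n C j) + + (n C suc j)) * h (suc j)
      ≡⟨ *-distribʳ-+ (h (suc j)) (+ (n C j)) (+ (n C suc j)) ⟩
    + (n C j) * h (suc j) + + (n C suc j) * h (suc j) ∎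

binomialSum-shift-relation :
  (G : ℤ → ℤ) (w c : ℤ) (d e : ℕ) → (∀ a → G a + w * G (a + + d) ≡ c * G (a + + e)) →
  ∀ n s → binomialSum n (λ j → w ^ j * G (+ (d ℕ.* j) + s)) ≡ c ^ n * G (+ (e ℕ.* n) + s)
binomialSum-shift-relation G w c d e relation zero s = begin
  + 1 * (1ℤ * G (+ (d ℕ.* 0) + s)) ≡⟨ trans (*-identityˡ _) (*-identityˡ _) ⟩
  G (+ (d ℕ.* 0) + s)             ≡⟨ cong (λ t → G (+ t + s)) (trans (ℕ.*-zeroʳ d) (sym (ℕ.*-zeroʳ e))) ⟩
  G (+ (e ℕ.* 0) + s)             ≡⟨ sym (*-identityˡ _) ⟩
  1ℤ * G (+ (e ℕ.* 0) + s)        ∎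
binomialSum-shift-relation G w c d e relation (suc n) s = begin
  binomialSum (suc n) (h s)
    ≡⟨ binomialSum-suc n (h s) ⟩
  binomialSum n (h s) + binomialSum n (λ j → h s (suc j))
    ≡⟨ cong (λ t → binomialSum n (h s) + t) (binomialSum-cong n shifted) ⟩
  binomialSum n (h s) + binomialSum n (λ j → w * h (s + + d) j)
    ≡⟨ cong (λ t → binomialSum n (h s) + t) (binomialSum-*ˡ n w (h (s + + d))) ⟩
  binomialSum n (h s) + w * binomialSum n (h (s + + d))
    ≡⟨ cong₂ (λ u v → u + w * v) (IH s) (IH (s + + d)) ⟩
  c ^ n * G a + w * (c ^ n * G (+ (e ℕ.* n) + (s + + d)))
    ≡⟨ cong (λ t → c ^ n * G a + w * (c ^ n * G t)) (sym (+-assoc (+ (e ℕ.* n)) s (+ d))) ⟩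
  c ^ n * G a + w * (c ^ n * G (a + + d))
    ≡⟨ factor (c ^ n) w (G a) (G (a + + d)) ⟩
  c ^ n * (G a + w * G (a + + d))
    ≡⟨ cong (c ^ n *_) (relation a) ⟩
  c ^ n * (c * G (a + + e))
    ≡⟨ regroup (c ^ n) c (G (a + + e)) ⟩
  c ^ suc n * G (a + + e)
    ≡⟨ cong (λ t → c ^ suc n * G t) (sym (shift-index e n s)) ⟩
  c ^ suc n * G (+ (e ℕ.* suc n) + s) ∎
  where
  h : ℤ → ℕ → ℤ
  h s j = w ^ j * G (+ (d ℕ.* j) + s)
  a = + (e ℕ.* n) + s
  IH = binomialSum-shift-relation G w c d e relation n
  shifted : ∀ j → h s (suc j) ≡ w * h (s + + d) j
  shifted j = begin
    w * w ^ j * G (+ (d ℕ.* suc j) + s)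
      ≡⟨ cong (λ t → w * w ^ j * G t) (trans (shift-index d j s) (+-assoc (+ (d ℕ.* j)) s (+ d))) ⟩
    w * w ^ j * G (+ (d ℕ.* j) + (s + + d))
      ≡⟨ *-assoc w (w ^ j) _ ⟩
    w * (w ^ j * G (+ (d ℕ.* j) + (s + + d))) ∎
  factor : ∀ x w u v → x * u + w * (x * v) ≡ x * (u + w * v)
  factor = solve-∀
  regroup : ∀ x c y → x * (c * y) ≡ c * x * y
  regroup = solve-∀

-- The binomial sums are padded with vanishing terms up to the odd bound 2⌊n/2⌋ + 1,
-- so that the indices pair up as (2k, 2k+1).
binomialSum-even : ∀ n (h : ℕ → ℤ) →
  + 2 * sumTo ⌊ n /2⌋ (λ k → + (n C (2 ℕ.* k)) * h (2 ℕ.* k))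
    ≡ binomialSum n h + binomialSum n (λ j → (- 1ℤ) ^ j * h j)
binomialSum-even n h = begin
  + 2 * sumTo m (λ k → + (n C (2 ℕ.* k)) * h (2 ℕ.* k))
    ≡⟨ sym (sumTo-*ˡ m (+ 2) _) ⟩
  sumTo m (λ k → + 2 * (+ (n C (2 ℕ.* k)) * h (2 ℕ.* k)))
    ≡⟨ sym (sumTo-cong m pair) ⟩
  sumTo m (λ k → f (2 ℕ.* k) + f (suc (2 ℕ.* k)))
    ≡⟨ sym (sumTo-pairs m f) ⟩
  sumTo (suc (2 ℕ.* m)) f
    ≡⟨ sumTo-+ (suc (2 ℕ.* m)) _ _ ⟩
  sumTo (suc (2 ℕ.* m)) (λ j → + (n C j) * h j)
    + sumTo (suc (2 ℕ.* m)) (λ j → + (n C j) * ((- 1ℤ) ^ j * h j))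
    ≡⟨ cong₂ _+_ (binomialSum-extend h (n≤1+2⌊n/2⌋ n))
                 (binomialSum-extend (λ j → (- 1ℤ) ^ j * h j) (n≤1+2⌊n/2⌋ n)) ⟩
  binomialSum n h + binomialSum n (λ j → (- 1ℤ) ^ j * h j) ∎
  where
  m = ⌊ n /2⌋
  f = λ j → + (n C j) * h j + + (n C j) * ((- 1ℤ) ^ j * h j)
  cancel : ∀ σ c x c' y → (c * x + c * (σ * x)) + (c' * y + c' * ((- 1ℤ * σ) * y))
                          ≡ c * x * (1ℤ + σ) + c' * y * (1ℤ - σ)
  cancel = solve-∀
  double : ∀ c x c' y → c * x * (1ℤ + 1ℤ) + c' * y * (1ℤ - 1ℤ) ≡ + 2 * (c * x)
  double = solve-∀
  pair : ∀ k → f (2 ℕ.* k) + f (suc (2 ℕ.* k)) ≡ + 2 * (+ (n C (2 ℕ.* k)) * h (2 ℕ.* k))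
  pair k = begin
    f (2 ℕ.* k) + f (suc (2 ℕ.* k))
      ≡⟨ cancel ((- 1ℤ) ^ (2 ℕ.* k)) c x c' y ⟩
    c * x * (1ℤ + (- 1ℤ) ^ (2 ℕ.* k)) + c' * y * (1ℤ - (- 1ℤ) ^ (2 ℕ.* k))
      ≡⟨ cong (λ t → c * x * (1ℤ + t) + c' * y * (1ℤ - t)) (-1^-even k) ⟩
    c * x * (1ℤ + 1ℤ) + c' * y * (1ℤ - 1ℤ)
      ≡⟨ double c x c' y ⟩
    + 2 * (c * x) ∎
    where
    c = + (n C (2 ℕ.* k))
    x = h (2 ℕ.* k)
    c' = + (n C suc (2 ℕ.* k))
    y = h (suc (2 ℕ.* k))

module _ (G : ℤ → ℤ) (recurrence : ∀ z → G (z + + 2) ≡ G (z + + 1) + G z) where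

  private
    G-step3 : ∀ a → G (a + + 3) ≡ G (a + + 2) + G (a + + 1)
    G-step3 a = begin
      G (a + + 3)                       ≡⟨ cong G (sym (+-assoc a (+ 1) (+ 2))) ⟩
      G ((a + + 1) + + 2)               ≡⟨ recurrence (a + + 1) ⟩
      G ((a + + 1) + + 1) + G (a + + 1) ≡⟨ cong (λ t → G t + G (a + + 1)) (+-assoc a (+ 1) (+ 1)) ⟩
      G (a + + 2) + G (a + + 1)         ∎

  shift3-sum : ∀ a → G a + 1ℤ * G (a + + 3) ≡ + 2 * G (a + + 2)
  shift3-sum a rewrite G-step3 a | recurrence a = identity (G a) (G (a + + 1))
    where
    identity : ∀ x y → x + 1ℤ * ((y + x) + y) ≡ + 2 * (y + x)
    identity = solve-∀

  shift3-difference : ∀ a → G a + (- 1ℤ) * G (a + + 3) ≡ (- + 2) * G (a + + 1)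
  shift3-difference a rewrite G-step3 a | recurrence a = identity (G a) (G (a + + 1))
    where
    identity : ∀ x y → x + (- 1ℤ) * ((y + x) + y) ≡ (- + 2) * y
    identity = solve-∀

  even-binomial-sum : ∀ n s →
    + 2 * sumTo ⌊ n /2⌋ (λ k → + (n C (2 ℕ.* k)) * G (+ (6 ℕ.* k) + s))
      ≡ (+ 2) ^ n * (G (+ (2 ℕ.* n) + s) + sign n * G (+ n + s))
  even-binomial-sum n s = begin
    + 2 * sumTo ⌊ n /2⌋ (λ k → + (n C (2 ℕ.* k)) * G (+ (6 ℕ.* k) + s))
      ≡⟨ cong (+ 2 *_) (sumTo-cong ⌊ n /2⌋ λ k → cong (λ t → + (n C (2 ℕ.* k)) * G (+ t + s))
                                                       (ℕ.*-assoc 3 2 k)) ⟩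
    + 2 * sumTo ⌊ n /2⌋ (λ k → + (n C (2 ℕ.* k)) * h (2 ℕ.* k))
      ≡⟨ binomialSum-even n h ⟩
    binomialSum n h + binomialSum n (λ j → (- 1ℤ) ^ j * h j)
      ≡⟨ cong (_+ binomialSum n (λ j → (- 1ℤ) ^ j * h j))
              (binomialSum-cong n λ j → sym (trans (cong (_* h j) (^-zeroˡ j)) (*-identityˡ (h j)))) ⟩
    binomialSum n (λ j → 1ℤ ^ j * h j) + binomialSum n (λ j → (- 1ℤ) ^ j * h j)
      ≡⟨ cong₂ _+_ (binomialSum-shift-relation G 1ℤ (+ 2) 3 2 shift3-sum n s)
                   (binomialSum-shift-relation G (- 1ℤ) (- + 2) 3 1 shift3-difference n s) ⟩
    (+ 2) ^ n * G (+ (2 ℕ.* n) + s) + (- + 2) ^ n * G (+ (1 ℕ.* n) + s)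
      ≡⟨ cong₂ (λ u t → (+ 2) ^ n * G (+ (2 ℕ.* n) + s) + u * G (+ t + s))
               (neg-^ (+ 2) n) (ℕ.*-identityˡ n) ⟩
    (+ 2) ^ n * G (+ (2 ℕ.* n) + s) + sign n * (+ 2) ^ n * G (+ n + s)
      ≡⟨ factor ((+ 2) ^ n) (sign n) _ _ ⟩
    (+ 2) ^ n * (G (+ (2 ℕ.* n) + s) + sign n * G (+ n + s)) ∎
    where
    h = λ j → G (+ (3 ℕ.* j) + s)
    factor : ∀ x σ u v → x * u + σ * x * v ≡ x * (u + σ * v)
    factor = solve-∀

theorem5 : (n : ℕ) (s : ℤ) →
    (+ 2 * sumTo ⌊ n /2⌋ (λ k → + (n C (2 ℕ.* k)) * F (+ (6 ℕ.* k) + s))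
      ≡ (+ 2) ^ n * (F (+ (2 ℕ.* n) + s) + sign n * F (+ n + s)))
    × (+ 2 * sumTo ⌊ n /2⌋ (λ k → + (n C (2 ℕ.* k)) * L (+ (6 ℕ.* k) + s))
      ≡ (+ 2) ^ n * (L (+ (2 ℕ.* n) + s) + sign n * L (+ n + s)))
theorem5 n s = even-binomial-sum F F-recurrence n s , even-binomial-sum L L-recurrence n s
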